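{- Let $S$ be a finite set of Boolean state variables, let $I(S)$ specify the initial states and $T(S,S')$ the transition relation of a transition system having the stuttering feature ($T(\mathbf{s},\mathbf{s})=1$ for every state $\mathbf{s}$), and let $n\ge 0$. Then $\mathrm{Di}(I,T)\le n$ if and only if $$\exists S_0\cup\dots\cup S_n\,\big[I_0\wedge T_{0,1}\wedge\dots\wedge T_{n,n+1}\big]\;\equiv\;\exists S_0\cup\dots\cup S_n\,\big[I_1\wedge T_{0,1}\wedge\dots\wedge T_{n,n+1}\big]$$ as formulas in the free variables $S_{n+1}$.
   Context: A state is an assignment to $S$. $S_j$ denotes a copy of the state variables for time frame $j$; $I_0=I(S_0)$, $I_1=I(S_1)$, $T_{j,j+1}=T(S_j,S_{j+1})$. A trace $\mathbf{s}_0,\dots,\mathbf{s}_k$ is valid if $I(\mathbf{s}_0)=1$ and $T(\mathbf{s}_i,\mathbf{s}_{i+1})=1$ for $i<k$; then $\mathbf{s}_k$ is reachable in $k$ transitions. $\mathrm{Di}(I,T)\le n$ means that every reachable state is reachable in at most $n$ transitions. -}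

module Defs where

open import Data.Nat using (ℕ; zero; suc; _≤_; _<_)
open import Data.Bool using (Bool; true)
open import Data.Vec using (Vec)
open import Data.Product using (Σ; _×_; ∃-syntax)
open import Relation.Binary.PropositionalEquality using (_≡_)

State : ℕ → Set
State m = Vec Bool m

Init : ℕ → Set
Init m = State m → Bool

Trans : ℕ → Set
Trans m = State m → State m → Bool

Stuttering : ∀ {m} → Trans m → Set
Stuttering {m} T = (s : State m) → T s s ≡ true

-- A valid trace s_0,...,s_k ending in s (states given as a function on ℕ; only 0..k matter).
ValidTrace : ∀ {m} → Init m → Trans m → (k : ℕ) → (ℕ → State m) → Set
ValidTrace I T k tr = (I (tr 0) ≡ true) × ((i : ℕ) → i < k → T (tr i) (tr (suc i)) ≡ true)

ReachableIn : ∀ {m} → Init m → Trans m → ℕ → State m → Set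
ReachableIn I T k s = ∃[ tr ] (ValidTrace I T k tr × tr k ≡ s)

DiameterLe : ∀ {m} → Init m → Trans m → ℕ → Set
DiameterLe {m} I T n =
  (s : State m) (k : ℕ) → ReachableIn I T k s → ∃[ j ] (j ≤ n × ReachableIn I T j s)

-- Given values for S_0,...,S_n (a function on ℕ, indices 0..n used) and s' for S_{n+1},
-- the chain T_{0,1} ∧ ... ∧ T_{n,n+1} holds.
Chain : ∀ {m} → Trans m → (n : ℕ) → (ℕ → State m) → State m → Set
Chain T n σ s' = ((i : ℕ) → i < n → T (σ i) (σ (suc i)) ≡ true) × (T (σ n) s' ≡ true)

-- ∃ S_0 ∪ ... ∪ S_n [ I_0 ∧ T_{0,1} ∧ ... ∧ T_{n,n+1} ]   evaluated at S_{n+1} = s'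
Formula0 : ∀ {m} → Init m → Trans m → ℕ → State m → Set
Formula0 I T n s' = ∃[ σ ] (I (σ 0) ≡ true × Chain T n σ s')

-- ∃ S_0 ∪ ... ∪ S_n [ I_1 ∧ T_{0,1} ∧ ... ∧ T_{n,n+1} ]   evaluated at S_{n+1} = s'
-- (I_1 = I(S_1); when n = 0, S_1 is the free variable s'.)
Formula1 : ∀ {m} → Init m → Trans m → ℕ → State m → Set
Formula1 I T zero s' = ∃[ σ ] (I s' ≡ true × Chain T zero σ s')
Formula1 I T (suc n) s' = ∃[ σ ] (I (σ 1) ≡ true × Chain T (suc n) σ s')

-- A state is reachable in k transitions iff it is reachable in at most k, because stuttering
-- pads short traces. The left formula holds at s exactly when s is reachable in n + 1
-- transitions and the right one exactly when s is reachable in n (the stuttering step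
-- T_{0,1} absorbs the unused S_0). Their equivalence thus says that every state reachable
-- in n + 1 transitions is reachable in n, and by induction on k the same then holds for
-- every k, which is Di(I,T) ≤ n.
module Submission where

open import Defs
open import Data.Nat using (ℕ; zero; suc; _≤_; _<_; _≤′_; ≤′-refl; ≤′-step; z≤n; s≤s; _≟_)
open import Data.Nat.Properties using (≤⇒≤′; ≤-refl; n<1+n; m<n⇒m<1+n; ≤∧≢⇒<; <⇒≢; suc-injective)
open import Data.Product using (_×_; _,_; proj₁; ∃-syntax)
open import Data.Bool using (true)
open import Relation.Binary.PropositionalEquality using (_≡_; refl)
open import Relation.Nullary using (yes; no; ¬_)
open import Data.Empty using (⊥-elim)
open import Function using (_∘_)

_[_≔_] : {A : Set} → (ℕ → A) → ℕ → A → ℕ → A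
(f [ k ≔ a ]) i with i ≟ k
... | yes _ = a
... | no _ = f i

update-same : {A : Set} (f : ℕ → A) (k : ℕ) (a : A) → (f [ k ≔ a ]) k ≡ a
update-same f k a with k ≟ k
... | yes _ = refl
... | no k≢k = ⊥-elim (k≢k refl)

update-other : {A : Set} (f : ℕ → A) {k : ℕ} (a : A) {i : ℕ} → ¬ i ≡ k → (f [ k ≔ a ]) i ≡ f i
update-other f {k} a {i} i≢k with i ≟ k
... | yes i≡k = ⊥-elim (i≢k i≡k)
... | no _ = refl

module _ {m : ℕ} (I : Init m) (T : Trans m) where

  reachableIn-zero : ∀ {s} → I s ≡ true → ReachableIn I T 0 s
  reachableIn-zero {s} Is = (λ _ → s) , (Is , λ _ ()) , refl

  reachableIn-zero-init : ∀ {s} → ReachableIn I T 0 s → I s ≡ true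
  reachableIn-zero-init (tr , (I₀ , _) , refl) = I₀

  reachableIn-suc : ∀ {k x s} → ReachableIn I T k x → T x s ≡ true → ReachableIn I T (suc k) s
  reachableIn-suc {k} {s = s} (tr , (I₀ , steps) , refl) Txs =
    tr′ , (I₀ , steps′) , update-same tr (suc k) s
    where
    tr′ : ℕ → State m
    tr′ = tr [ suc k ≔ s ]

    steps′ : (i : ℕ) → i < suc k → T (tr′ i) (tr′ (suc i)) ≡ true
    steps′ i (s≤s i≤k) with i ≟ k
    ... | yes refl
      rewrite update-same tr (suc i) s | update-other tr s {i} (<⇒≢ (n<1+n i)) = Txs
    ... | no i≢k
      rewrite update-other tr s {i} (<⇒≢ (s≤s i≤k)) | update-other tr s {suc i} (i≢k ∘ suc-injective) =
      steps i (≤∧≢⇒< i≤k i≢k)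

  reachableIn-pred : ∀ {k s} → ReachableIn I T (suc k) s → ∃[ x ] (ReachableIn I T k x × T x s ≡ true)
  reachableIn-pred {k} (tr , (I₀ , steps) , refl) =
    tr k , (tr , (I₀ , λ i i<k → steps i (m<n⇒m<1+n i<k)) , refl) , steps k (n<1+n k)

  formula0⇒reachableIn : ∀ n {s} → Formula0 I T n s → ReachableIn I T (suc n) s
  formula0⇒reachableIn n (σ , I₀ , steps , Tσs) = reachableIn-suc (σ , (I₀ , steps) , refl) Tσs

  reachableIn⇒formula0 : ∀ n {s} → ReachableIn I T (suc n) s → Formula0 I T n s
  reachableIn⇒formula0 n (tr , (I₀ , steps) , refl) =
    tr , I₀ , (λ i i<n → steps i (m<n⇒m<1+n i<n)) , steps n (n<1+n n)

  formula1⇒reachableIn : ∀ n {s} → Formula1 I T n s → ReachableIn I T n s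
  formula1⇒reachableIn zero (_ , Is , _) = reachableIn-zero Is
  formula1⇒reachableIn (suc n) (σ , I₁ , steps , Tσs) =
    formula0⇒reachableIn n (σ ∘ suc , I₁ , (λ i i<n → steps (suc i) (s≤s i<n)) , Tσs)

  ReachableStable : ℕ → Set
  ReachableStable n = ∀ {s} → ReachableIn I T (suc n) s → ReachableIn I T n s

  module _ (stut : Stuttering T) where

    reachableIn-stutter : ∀ {k s} → ReachableIn I T k s → ReachableIn I T (suc k) s
    reachableIn-stutter {s = s} r = reachableIn-suc r (stut s)

    reachableIn-mono : ∀ {j k s} → j ≤ k → ReachableIn I T j s → ReachableIn I T k s
    reachableIn-mono = go ∘ ≤⇒≤′
      where
      go : ∀ {j k s} → j ≤′ k → ReachableIn I T j s → ReachableIn I T k s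
      go ≤′-refl = λ r → r
      go (≤′-step j≤k) = reachableIn-stutter ∘ go j≤k

    -- The stuttering step T(S_0, S_1) lets S_0 repeat the initial state of the trace.
    reachableIn⇒formula1 : ∀ n {s} → ReachableIn I T n s → Formula1 I T n s
    reachableIn⇒formula1 zero {s} r = (λ _ → s) , reachableIn-zero-init r , (λ _ ()) , stut s
    reachableIn⇒formula1 (suc n) r with reachableIn⇒formula0 n r
    ... | σ , I₀ , steps , Tσs = σ′ , I₀ , steps′ , Tσs
      where
      σ′ : ℕ → State m
      σ′ zero = σ 0
      σ′ (suc i) = σ i

      steps′ : (i : ℕ) → i < suc n → T (σ′ i) (σ′ (suc i)) ≡ true
      steps′ zero _ = stut (σ 0)
      steps′ (suc i) (s≤s i<n) = steps i i<n

    diameterLe⇒stable : ∀ {n} → DiameterLe I T n → ReachableStable n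
    diameterLe⇒stable {n} di {s} r with di s (suc n) r
    ... | j , j≤n , rj = reachableIn-mono j≤n rj

    stable⇒diameterLe : ∀ {n} → ReachableStable n → DiameterLe I T n
    stable⇒diameterLe {n} stable s k r = n , ≤-refl , reach k r
      where
      reach : ∀ k {s} → ReachableIn I T k s → ReachableIn I T n s
      reach zero r = reachableIn-mono z≤n r
      reach (suc k) r with reachableIn-pred r
      ... | x , rx , Txs = stable (reachableIn-suc (reach k rx) Txs)

lemma1 : {m : ℕ} (I : Init m) (T : Trans m) → Stuttering T → (n : ℕ) →
    (DiameterLe I T n →
       ((s' : State m) → (Formula0 I T n s' → Formula1 I T n s') × (Formula1 I T n s' → Formula0 I T n s')))
    × (((s' : State m) → (Formula0 I T n s' → Formula1 I T n s') × (Formula1 I T n s' → Formula0 I T n s'))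
       → DiameterLe I T n)
lemma1 I T stut n =
    (λ di s' →
       (reachableIn⇒formula1 I T stut n ∘ diameterLe⇒stable I T stut di
         ∘ formula0⇒reachableIn I T n)
     , (reachableIn⇒formula0 I T n ∘ reachableIn-stutter I T stut ∘ formula1⇒reachableIn I T n))
  , (λ equiv → stable⇒diameterLe I T stut λ {s} →
       formula1⇒reachableIn I T n ∘ proj₁ (equiv s) ∘ reachableIn⇒formula0 I T n)
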